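{- Let $q$ be a power of an odd prime. Then the polynomials \begin{enumerate} \item $X^2-X^{q+1}-X^{q^2+1}+X^{2q}+X^{2q^2}$ and \item $X^2+X^{q+1}+X^{q^2+1}+\tfrac12 X^{2q}+\tfrac12 X^{2q^2}$ \end{enumerate} are planar over $\mathbb{F}_{q^3}$.
   Context: For $q$ odd, a function $f:\mathbb{F}_{q^n}\to\mathbb{F}_{q^n}$ is called planar (over $\mathbb{F}_{q^n}$) if for every $\epsilon\in\mathbb{F}_{q^n}^*$ the polynomial $f(X+\epsilon)-f(X)$ induces a permutation of $\mathbb{F}_{q^n}$. -}

module Defs where

open import Level using (Level; _⊔_)
open import Data.Nat using (ℕ; zero; suc)
open import Data.Fin using (Fin)
open import Data.Product using (Σ; ∃; _×_)
open import Relation.Nullary using (¬_)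
open import Relation.Binary.PropositionalEquality using (_≡_)
open import Algebra.Bundles using (CommutativeRing)

module _ {c ℓ : Level} (F : CommutativeRing c ℓ) where
  open CommutativeRing F

  pow : Carrier → ℕ → Carrier
  pow x zero    = 1#
  pow x (suc n) = x * pow x n

  -- Any such F is (isomorphic to) the field F_n.
  record IsFiniteFieldOfOrder (n : ℕ) : Set (c ⊔ ℓ) where
    field
      one≉zero   : ¬ (1# ≈ 0#)
      invertible : ∀ x → ¬ (x ≈ 0#) → ∃ λ y → x * y ≈ 1#
      toFin      : Carrier → Fin n
      fromFin    : Fin n → Carrier
      toFin-cong : ∀ {x y} → x ≈ y → toFin x ≡ toFin y
      from-to    : ∀ x → fromFin (toFin x) ≈ x
      to-from    : ∀ i → toFin (fromFin i) ≡ i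

  IsPermutation : (Carrier → Carrier) → Set (c ⊔ ℓ)
  IsPermutation g = (∀ x y → g x ≈ g y → x ≈ y) × (∀ y → ∃ λ x → g x ≈ y)

  Planar : (Carrier → Carrier) → Set (c ⊔ ℓ)
  Planar f = ∀ ε → ¬ (ε ≈ 0#) → IsPermutation (λ x → f (x + ε) - f x)

  f₁ : ℕ → Carrier → Carrier
  f₁ q x = pow x 2 - pow x (q Data.Nat.+ 1) - pow x (q Data.Nat.* q Data.Nat.+ 1)
           + pow x (2 Data.Nat.* q) + pow x (2 Data.Nat.* (q Data.Nat.* q))

  -- X^2 + X^{q+1} + X^{q^2+1} + h X^{2q} + h X^{2q^2}, where h = 1/2
  f₂ : ℕ → Carrier → Carrier → Carrier
  f₂ q h x = pow x 2 + pow x (q Data.Nat.+ 1) + pow x (q Data.Nat.* q Data.Nat.+ 1)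
             + h * pow x (2 Data.Nat.* q) + h * pow x (2 Data.Nat.* (q Data.Nat.* q))

{-# OPTIONS --safe #-}

-- Let σ x = x ^ q be the Frobenius map of F = F_{q³}: a ring endomorphism (the field has
-- characteristic p and q is a power of p) with σ³ = id (x ^ (q³) = x by Lagrange's theorem for
-- the multiplicative group).  Both polynomials are quadratic forms Q (x, σ x, σ² x), so
-- f (x + ε) - f x - (f (y + ε) - f y) = β (x - y, ε) for the polarisation β of Q, and f is
-- planar as soon as β (a, ε) = 0 with ε ≠ 0 forces a = 0.  Since σ fixes the integer
-- coefficients of β, β (a, ε) = 0 implies β (σ a, σ ε) = β (σ² a, σ² ε) = 0, and a fixed integer
-- combination of these three values equals 2 μ(a) μ(ε) for the linear form
-- μ x = x - σ x - σ² x (for f₁), respectively μ x = σ x + σ² x (for f₂).  As 2 is cancellable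
-- (p is odd, respectively 2 h = 1) and F has no zero divisors, μ a = 0 or μ ε = 0, and the same
-- conjugation argument applied to μ shows that μ c = 0 only for c = 0.

module Submission where

open import Defs
open import Level using (Level)
open import Data.Nat using (ℕ; _^_; _≤_)
open import Data.Nat.Primality using (Prime)
open import Data.Product using (_×_)
open import Relation.Nullary using (¬_)
open import Relation.Binary.PropositionalEquality using (_≡_)
open import Algebra.Bundles using (CommutativeRing)

open import Algebra.Bundles using (CommutativeMonoid)
open import Data.Nat as ℕ using (zero; suc; _<_; _∸_; _!; NonZero)
import Data.Nat.Properties as ℕ
open import Data.Nat.Divisibility using (_∣_; divides; ∣1⇒≡1; ∣⇒≤; m∣m*n)
open import Data.Nat.Primality using (¬prime[1]; euclidsLemma; prime⇒nonZero; prime⇒irreducible)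
open import Data.Nat.Combinatorics using (_C_; nCk≡n!/k![n-k]!; k![n∸k]!∣n!; nCn≡1)
open import Data.Nat.DivMod using (m/n*n≡m; _%_; _/_; m≡m%n+[m/n]*n; m%n<n)
open import Data.Integer as ℤ using (ℤ; +_; -[1+_]; _⊖_; _◃_; sign; ∣_∣; 0ℤ; -1ℤ)
import Data.Integer.Properties as ℤ
open import Data.Sign as Sign using (Sign)
open import Data.Fin as Fin using (Fin)
import Data.Fin.Properties as Fin
open import Data.Fin.Permutation using (Permutation; permutation)
open import Data.Vec as Vec using (Vec; []; _∷_; _++_)
import Data.Vec.Properties as Vec
open import Data.Vec.Relation.Binary.Pointwise.Inductive as Pointwise using (Pointwise; []; _∷_)
open import Data.Maybe as Maybe using (Maybe)
open import Data.Product using (_,_; ∃)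
open import Data.Sum using (_⊎_; inj₁; inj₂; [_,_]′)
open import Function using (_∘_; id)
open import Function.Definitions using (Injective)
open import Relation.Nullary using (yes; no; dec⇒maybe; contradiction)
import Relation.Nullary.Decidable as Dec
open import Relation.Binary.Definitions using (Decidable)
import Relation.Binary.PropositionalEquality as ≡
open import Relation.Binary.PropositionalEquality using (_≢_)

prime∣m!⇒p≤m : ∀ {p} → Prime p → ∀ m → p ∣ m ! → p ≤ m
prime∣m!⇒p≤m p-prime zero    p∣1  = contradiction (≡.subst Prime (∣1⇒≡1 p∣1) p-prime) ¬prime[1]
prime∣m!⇒p≤m p-prime (suc m) p∣m! with euclidsLemma (suc m) (m !) p-prime p∣m!
... | inj₁ p∣1+m = ∣⇒≤ p∣1+m
... | inj₂ p∣m!′ = ℕ.m≤n⇒m≤1+n (prime∣m!⇒p≤m p-prime m p∣m!′)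

nCk*k![n∸k]!≡n! : ∀ {n k} → k ≤ n → (n C k) ℕ.* (k ! ℕ.* (n ∸ k) !) ≡ n !
nCk*k![n∸k]!≡n! {n} {k} k≤n =
  ≡.trans (≡.cong (ℕ._* (k ! ℕ.* (n ∸ k) !)) (nCk≡n!/k![n-k]! k≤n)) (m/n*n≡m {{_}} (k![n∸k]!∣n! k≤n))

prime∣pCk : ∀ {p k} → Prime p → 0 < k → k < p → p ∣ p C k
prime∣pCk {p@(suc p-1)} {k} p-prime 0<k k<p
  with euclidsLemma (p C k) (k ! ℕ.* (p ∸ k) !) p-prime
         (≡.subst (p ∣_) (≡.sym (nCk*k![n∸k]!≡n! (ℕ.<⇒≤ k<p))) (m∣m*n (p-1 !)))
... | inj₁ p∣pCk = p∣pCk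
... | inj₂ p∣k![p∸k]! with euclidsLemma (k !) ((p ∸ k) !) p-prime p∣k![p∸k]!
...   | inj₁ p∣k!     = contradiction (prime∣m!⇒p≤m p-prime k p∣k!) (ℕ.<⇒≱ k<p)
...   | inj₂ p∣[p∸k]! =
  contradiction (prime∣m!⇒p≤m p-prime (p ∸ k) p∣[p∸k]!) (ℕ.<⇒≱ (ℕ.∸-monoʳ-< 0<k (ℕ.<⇒≤ k<p)))

prime≢2⇒odd : ∀ {p} → Prime p → p ≢ 2 → ∃ λ m → p ≡ suc (m ℕ.* 2)
prime≢2⇒odd {p} p-prime p≢2 with p % 2 | m≡m%n+[m/n]*n p 2 | m%n<n p 2
... | 0 | p≡[p/2]*2 | _ with prime⇒irreducible p-prime (divides (p / 2) p≡[p/2]*2)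
...   | inj₁ ()
...   | inj₂ 2≡p = contradiction (≡.sym 2≡p) p≢2
prime≢2⇒odd {p} p-prime p≢2 | 1 | p≡1+[p/2]*2 | _ = p / 2 , p≡1+[p/2]*2
prime≢2⇒odd {p} p-prime p≢2 | suc (suc _) | _ | ℕ.s≤s (ℕ.s≤s ())

injective⇒surjective : ∀ {n} (f : Fin n → Fin n) → Injective _≡_ _≡_ f → ∀ j → ∃ λ i → f i ≡ j
injective⇒surjective {n} f f-inj j with Fin.any? (λ i → f i Fin.≟ j)
... | yes hit = hit
injective⇒surjective {suc n} f f-inj j | no miss = contradiction (Fin.injective⇒≤ g-inj) ℕ.1+n≰n
  where
  j≢f : ∀ i → j ≢ f i
  j≢f i j≡fi = miss (i , ≡.sym j≡fi)
  g : Fin (suc n) → Fin n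
  g i = Fin.punchOut (j≢f i)
  g-inj : Injective _≡_ _≡_ g
  g-inj {i₁} {i₂} gi₁≡gi₂ = f-inj (Fin.punchOut-injective (j≢f i₁) (j≢f i₂) gi₁≡gi₂)

module _ {a ℓ} (M : CommutativeMonoid a ℓ) where
  open CommutativeMonoid M
  open import Algebra.Properties.CommutativeMonoid.Sum M using (sum; sum-remove; sum-cong-≋)
  open import Algebra.Properties.CommutativeSemigroup commutativeSemigroup using (x∙yz≈y∙xz)
  open import Relation.Binary.Reasoning.Setoid setoid

  sum-exchange : ∀ {n} (t u : Fin n → Carrier) (z : Fin n)
               → (∀ i → i ≢ z → t i ≈ u i) → u z ∙ sum t ≈ t z ∙ sum u
  sum-exchange {suc n} t u z t≈u = begin
    u z ∙ sum t                              ≈⟨ ∙-congˡ (sum-remove t) ⟩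
    u z ∙ (t z ∙ sum (t ∘ Fin.punchIn z))    ≈⟨ x∙yz≈y∙xz (u z) (t z) _ ⟩
    t z ∙ (u z ∙ sum (t ∘ Fin.punchIn z))    ≈⟨ ∙-congˡ (∙-congˡ (sum-cong-≋ (λ i → t≈u _ (Fin.punchInᵢ≢i z i)))) ⟩
    t z ∙ (u z ∙ sum (u ∘ Fin.punchIn z))    ≈⟨ ∙-congˡ (sum-remove u) ⟨
    t z ∙ sum u                              ∎

module Powers {c ℓ} (R : CommutativeRing c ℓ) where
  open CommutativeRing R
  import Algebra.Properties.Semiring.Exp semiring as Exp
  import Algebra.Properties.CommutativeSemiring.Exp commutativeSemiring as CExp
  open import Algebra.Properties.Semiring.Mult semiring using (×1-homo-*) renaming (_×_ to _·_)

  infixr 8 _^ᴿ_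
  _^ᴿ_ : Carrier → ℕ → Carrier
  _^ᴿ_ = pow R

  pow≡^ : ∀ x n → x ^ᴿ n ≡ x Exp.^ n
  pow≡^ x zero    = ≡.refl
  pow≡^ x (suc n) = ≡.cong (x *_) (pow≡^ x n)

  pow-cong : ∀ n {x y} → x ≈ y → x ^ᴿ n ≈ y ^ᴿ n
  pow-cong n {x} {y} x≈y rewrite pow≡^ x n | pow≡^ y n = Exp.^-congˡ n x≈y

  pow-+ : ∀ x m n → x ^ᴿ (m ℕ.+ n) ≈ x ^ᴿ m * x ^ᴿ n
  pow-+ x m n rewrite pow≡^ x (m ℕ.+ n) | pow≡^ x m | pow≡^ x n = Exp.^-homo-* x m n

  pow-* : ∀ x m n → x ^ᴿ (m ℕ.* n) ≈ (x ^ᴿ m) ^ᴿ n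
  pow-* x m n rewrite pow≡^ (x ^ᴿ m) n | pow≡^ x (m ℕ.* n) | pow≡^ x m = sym (Exp.^-assocʳ x m n)

  pow-distrib-* : ∀ x y n → (x * y) ^ᴿ n ≈ x ^ᴿ n * y ^ᴿ n
  pow-distrib-* x y n rewrite pow≡^ (x * y) n | pow≡^ x n | pow≡^ y n = CExp.^-distrib-* x y n

  ×1-homo-^ : ∀ m n → (m ℕ.^ n) · 1# ≈ (m · 1#) ^ᴿ n
  ×1-homo-^ m zero    = +-identityʳ 1#
  ×1-homo-^ m (suc n) = trans (×1-homo-* m (m ℕ.^ n)) (*-congˡ (×1-homo-^ m n))

  pow-+1 : ∀ x n → x ^ᴿ (n ℕ.+ 1) ≈ x ^ᴿ n * x
  pow-+1 x n = trans (pow-+ x n 1) (*-congˡ (*-identityʳ x))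

  pow-2* : ∀ x n → x ^ᴿ (2 ℕ.* n) ≈ x ^ᴿ n * x ^ᴿ n
  pow-2* x n = trans (pow-+ x n (n ℕ.+ 0)) (*-congˡ (reflexive (≡.cong (x ^ᴿ_) (ℕ.+-identityʳ n))))

  pow-zeroˡ : ∀ n .{{_ : NonZero n}} → 0# ^ᴿ n ≈ 0#
  pow-zeroˡ (suc n) = zeroˡ _

  pow-1# : ∀ n → 1# ^ᴿ n ≈ 1#
  pow-1# zero    = refl
  pow-1# (suc n) = trans (*-identityˡ _) (pow-1# n)

module IntegerCoefficients {c ℓ} (R : CommutativeRing c ℓ) where
  open CommutativeRing R
  open import Relation.Binary.Reasoning.Setoid setoid
  open import Algebra.Properties.Ring ring using (-‿involutive; -0#≈0#; -‿distribˡ-*; -1*x≈-x)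
  open import Algebra.Properties.AbelianGroup +-abelianGroup using (⁻¹-∙-comm)
  open import Algebra.Properties.CommutativeSemigroup +-commutativeSemigroup
    using () renaming (interchange to +-interchange)
  open import Algebra.Properties.CommutativeSemigroup *-commutativeSemigroup
    using () renaming (interchange to *-interchange)
  open import Algebra.Properties.Semiring.Mult.TCOptimised semiring
    using (1+×; ×-homo-+; ×1-homo-*) renaming (_×_ to _·_)
  open import Algebra.Properties.Semiring.Exp semiring using (^-congˡ)
  open import Algebra.Solver.Ring.AlmostCommutativeRing using (fromCommutativeRing; _-Raw-AlmostCommutative⟶_)

  -- The type-checking-optimised multiplication makes fromℤ (+ 1) and fromℤ (+ 2) reduce to 1#
  -- and 1# + 1#, so integer constants in solver goals match hand-written ring expressions.
  fromℤ : ℤ → Carrier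
  fromℤ (+ n)    = n · 1#
  fromℤ -[1+ n ] = - (suc n · 1#)

  private
    -‿homo-+ : ∀ x y → - (x + y) ≈ - x + - y
    -‿homo-+ x y = sym (⁻¹-∙-comm x y)

  fromℤ-⊖ : ∀ m n → fromℤ (m ⊖ n) ≈ m · 1# - n · 1#
  fromℤ-⊖ m       zero    = sym (trans (+-congˡ -0#≈0#) (+-identityʳ _))
  fromℤ-⊖ zero    (suc n) = sym (+-identityˡ _)
  fromℤ-⊖ (suc m) (suc n) = begin
    fromℤ (suc m ⊖ suc n)          ≡⟨ ≡.cong fromℤ (ℤ.[1+m]⊖[1+n]≡m⊖n m n) ⟩
    fromℤ (m ⊖ n)                  ≈⟨ fromℤ-⊖ m n ⟩
    m · 1# - n · 1#                ≈⟨ 1#-cancel (m · 1#) (n · 1#) ⟨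
    (1# + m · 1#) - (1# + n · 1#)  ≈⟨ +-cong (1+× m 1#) (-‿cong (1+× n 1#)) ⟨
    suc m · 1# - suc n · 1#        ∎
    where
    1#-cancel : ∀ a b → (1# + a) - (1# + b) ≈ a - b
    1#-cancel a b = begin
      (1# + a) + - (1# + b)   ≈⟨ +-congˡ (-‿homo-+ 1# b) ⟩
      (1# + a) + (- 1# + - b) ≈⟨ +-interchange 1# a (- 1#) (- b) ⟩
      (1# - 1#) + (a - b)     ≈⟨ +-congʳ (-‿inverseʳ 1#) ⟩
      0# + (a - b)            ≈⟨ +-identityˡ _ ⟩
      a - b                   ∎

  fromℤ-homo-+ : ∀ i j → fromℤ (i ℤ.+ j) ≈ fromℤ i + fromℤ j
  fromℤ-homo-+ (+ m)    (+ n)    = ×-homo-+ 1# m n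
  fromℤ-homo-+ (+ m)    -[1+ n ] = fromℤ-⊖ m (suc n)
  fromℤ-homo-+ -[1+ m ] (+ n)    = trans (fromℤ-⊖ n (suc m)) (+-comm _ _)
  fromℤ-homo-+ -[1+ m ] -[1+ n ] = begin
    - (suc (suc (m ℕ.+ n)) · 1#)      ≡⟨ ≡.cong (λ k → - (k · 1#)) (ℕ.+-suc (suc m) n) ⟨
    - ((suc m ℕ.+ suc n) · 1#)        ≈⟨ -‿cong (×-homo-+ 1# (suc m) (suc n)) ⟩
    - (suc m · 1# + suc n · 1#)       ≈⟨ -‿homo-+ _ _ ⟩
    - (suc m · 1#) + - (suc n · 1#)   ∎

  fromℤ-homo-‿ : ∀ i → fromℤ (ℤ.- i) ≈ - fromℤ i
  fromℤ-homo-‿ (+ zero)  = sym -0#≈0#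
  fromℤ-homo-‿ (+ suc n) = refl
  fromℤ-homo-‿ -[1+ n ]  = sym (-‿involutive _)

  fromSign : Sign → Carrier
  fromSign Sign.+ = 1#
  fromSign Sign.- = - 1#

  fromSign-homo-* : ∀ s t → fromSign (s Sign.* t) ≈ fromSign s * fromSign t
  fromSign-homo-* Sign.+ t      = sym (*-identityˡ _)
  fromSign-homo-* Sign.- Sign.+ = sym (*-identityʳ _)
  fromSign-homo-* Sign.- Sign.- = begin
    1#             ≈⟨ -‿involutive 1# ⟨
    - (- 1#)       ≈⟨ -‿cong (*-identityˡ _) ⟨
    - (1# * - 1#)  ≈⟨ -‿distribˡ-* 1# (- 1#) ⟩
    - 1# * - 1#    ∎

  fromℤ-◃ : ∀ s n → fromℤ (s ◃ n) ≈ fromSign s * n · 1#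
  fromℤ-◃ s      zero    = sym (zeroʳ _)
  fromℤ-◃ Sign.+ (suc n) = sym (*-identityˡ _)
  fromℤ-◃ Sign.- (suc n) = sym (-1*x≈-x _)

  fromℤ-sign-abs : ∀ i → fromℤ i ≈ fromSign (sign i) * ∣ i ∣ · 1#
  fromℤ-sign-abs i = trans (reflexive (≡.cong fromℤ (≡.sym (ℤ.◃-inverse i)))) (fromℤ-◃ (sign i) ∣ i ∣)

  fromℤ-homo-* : ∀ i j → fromℤ (i ℤ.* j) ≈ fromℤ i * fromℤ j
  fromℤ-homo-* i j = begin
    fromℤ (i ℤ.* j)
      ≈⟨ fromℤ-◃ (sign i Sign.* sign j) (∣ i ∣ ℕ.* ∣ j ∣) ⟩
    fromSign (sign i Sign.* sign j) * (∣ i ∣ ℕ.* ∣ j ∣) · 1#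
      ≈⟨ *-cong (fromSign-homo-* (sign i) (sign j)) (×1-homo-* ∣ i ∣ ∣ j ∣) ⟩
    (fromSign (sign i) * fromSign (sign j)) * (∣ i ∣ · 1# * ∣ j ∣ · 1#)
      ≈⟨ *-interchange _ _ _ _ ⟩
    (fromSign (sign i) * ∣ i ∣ · 1#) * (fromSign (sign j) * ∣ j ∣ · 1#)
      ≈⟨ *-cong (fromℤ-sign-abs i) (fromℤ-sign-abs j) ⟨
    fromℤ i * fromℤ j ∎

  fromℤ-homomorphism : ℤ.+-*-rawRing -Raw-AlmostCommutative⟶ fromCommutativeRing R
  fromℤ-homomorphism = record
    { ⟦_⟧    = fromℤ
    ; +-homo = fromℤ-homo-+
    ; *-homo = fromℤ-homo-*
    ; -‿homo = fromℤ-homo-‿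
    ; 0-homo = refl
    ; 1-homo = refl
    }

  fromℤ-≟ : ∀ i j → Maybe (fromℤ i ≈ fromℤ j)
  fromℤ-≟ i j = Maybe.map (reflexive ∘ ≡.cong fromℤ) (dec⇒maybe (i ℤ.≟ j))

  open import Algebra.Solver.Ring ℤ.+-*-rawRing (fromCommutativeRing R) fromℤ-homomorphism fromℤ-≟ public

  ⟦⟧-cong : ∀ {n} (e : Polynomial n) {ρ ρ′} → Pointwise _≈_ ρ ρ′ → ⟦ e ⟧ ρ ≈ ⟦ e ⟧ ρ′
  ⟦⟧-cong (op [+] e₁ e₂) ρ≋ρ′ = +-cong (⟦⟧-cong e₁ ρ≋ρ′) (⟦⟧-cong e₂ ρ≋ρ′)
  ⟦⟧-cong (op [*] e₁ e₂) ρ≋ρ′ = *-cong (⟦⟧-cong e₁ ρ≋ρ′) (⟦⟧-cong e₂ ρ≋ρ′)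
  ⟦⟧-cong (con c)        ρ≋ρ′ = refl
  ⟦⟧-cong (var x)        ρ≋ρ′ = Pointwise.lookup ρ≋ρ′ x
  ⟦⟧-cong (e :^ n)       ρ≋ρ′ = ^-congˡ n (⟦⟧-cong e ρ≋ρ′)
  ⟦⟧-cong (:- e)         ρ≋ρ′ = -‿cong (⟦⟧-cong e ρ≋ρ′)

  inverse-of-2-halving : ∀ {h} → (1# + 1#) * h ≈ 1# → ∀ {x} → x + x ≈ 0# → x ≈ 0#
  inverse-of-2-halving {h} 2h≈1 {x} x+x≈0 = begin
    x                      ≈⟨ *-identityˡ x ⟨
    1# * x                 ≈⟨ *-congʳ 2h≈1 ⟨
    ((1# + 1#) * h) * x    ≈⟨ solve 2 (λ h x → con (+ 2) :* h :* x := h :* (x :+ x)) refl h x ⟩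
    h * (x + x)            ≈⟨ *-congˡ x+x≈0 ⟩
    h * 0#                 ≈⟨ zeroʳ h ⟩
    0#                     ∎

module Frobenius {c ℓ} (R : CommutativeRing c ℓ) where
  open CommutativeRing R
  open import Relation.Binary.Reasoning.Setoid setoid
  open import Algebra.Properties.Semiring.Mult semiring
    using (×-congʳ; ×-assoc-*; ×-assocˡ) renaming (_×_ to _·_)
  import Algebra.Properties.Semiring.Exp semiring as Exp
  import Algebra.Properties.CommutativeMonoid.Sum +-commutativeMonoid as Σ
  import Algebra.Properties.CommutativeSemiring.Binomial commutativeSemiring as Binomial
  open Powers R

  freshmans-dream : ∀ p .{{_ : NonZero p}} → (∀ j z → 0 < j → j < p → (p C j) · z ≈ 0#)
                  → ∀ x y → (x + y) ^ᴿ p ≈ x ^ᴿ p + y ^ᴿ p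
  freshmans-dream (suc n) middle≈0 x y
    rewrite pow≡^ (x + y) (suc n) | pow≡^ x (suc n) | pow≡^ y (suc n) = begin
    (x + y) Exp.^ suc n
      ≈⟨ Binomial.theorem (suc n) x y ⟩
    t Fin.zero + Σ.sum (t ∘ Fin.suc)
      ≈⟨ +-congˡ (Σ.sum-init-last (t ∘ Fin.suc)) ⟩
    t Fin.zero + (Σ.sum (t ∘ Fin.suc ∘ Fin.inject₁) + t (Fin.suc (Fin.fromℕ n)))
      ≈⟨ +-congˡ (+-congʳ (trans (Σ.sum-cong-≋ inner≈0) (Σ.sum-replicate-zero n))) ⟩
    t Fin.zero + (0# + t (Fin.suc (Fin.fromℕ n)))
      ≈⟨ +-cong first (trans (+-identityˡ _) last) ⟩
    y Exp.^ suc n + x Exp.^ suc n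
      ≈⟨ +-comm _ _ ⟩
    x Exp.^ suc n + y Exp.^ suc n ∎
    where
    t : Fin (suc (suc n)) → Carrier
    t = Binomial.binomialTerm x y (suc n)
    first : t Fin.zero ≈ y Exp.^ suc n
    first = trans (+-identityʳ _) (*-identityˡ _)
    last : t (Fin.suc (Fin.fromℕ n)) ≈ x Exp.^ suc n
    last rewrite Fin.toℕ-fromℕ n | nCn≡1 (suc n) | ℕ.n∸n≡0 n = trans (+-identityʳ _) (*-identityʳ _)
    inner≈0 : ∀ i → t (Fin.suc (Fin.inject₁ i)) ≈ 0#
    inner≈0 i =
      middle≈0 _ _ (ℕ.s≤s ℕ.z≤n) (ℕ.s≤s (≡.subst (_< n) (≡.sym (Fin.toℕ-inject₁ i)) (Fin.toℕ<n i)))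

  module _ {p} (p-prime : Prime p) (char-p : p · 1# ≈ 0#) where

    p·x≈0 : ∀ x → p · x ≈ 0#
    p·x≈0 x = begin
      p · x          ≈⟨ ×-congʳ p (*-identityˡ x) ⟨
      p · (1# * x)   ≈⟨ ×-assoc-* p 1# x ⟨
      (p · 1#) * x   ≈⟨ *-congʳ char-p ⟩
      0# * x         ≈⟨ zeroˡ x ⟩
      0#             ∎

    pCj·x≈0 : ∀ j x → 0 < j → j < p → (p C j) · x ≈ 0#
    pCj·x≈0 j x 0<j j<p with divides d pCj≡d*p ← prime∣pCk p-prime 0<j j<p = begin
      (p C j) · x      ≡⟨ ≡.cong (_· x) (≡.trans pCj≡d*p (ℕ.*-comm d p)) ⟩
      (p ℕ.* d) · x    ≈⟨ ×-assocˡ x p d ⟨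
      p · (d · x)      ≈⟨ p·x≈0 (d · x) ⟩
      0#               ∎

    frobenius-homo-+ : ∀ x y → (x + y) ^ᴿ p ≈ x ^ᴿ p + y ^ᴿ p
    frobenius-homo-+ = freshmans-dream p {{prime⇒nonZero p-prime}} pCj·x≈0

    frobenius-power-homo-+ : ∀ k x y → (x + y) ^ᴿ (p ℕ.^ k) ≈ x ^ᴿ (p ℕ.^ k) + y ^ᴿ (p ℕ.^ k)
    frobenius-power-homo-+ zero    x y = trans (*-identityʳ _) (sym (+-cong (*-identityʳ x) (*-identityʳ y)))
    frobenius-power-homo-+ (suc k) x y = begin
      (x + y) ^ᴿ (p ℕ.* p ℕ.^ k)                   ≈⟨ pow-* (x + y) p (p ℕ.^ k) ⟩
      ((x + y) ^ᴿ p) ^ᴿ (p ℕ.^ k)                  ≈⟨ pow-cong (p ℕ.^ k) (frobenius-homo-+ x y) ⟩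
      (x ^ᴿ p + y ^ᴿ p) ^ᴿ (p ℕ.^ k)               ≈⟨ frobenius-power-homo-+ k (x ^ᴿ p) (y ^ᴿ p) ⟩
      (x ^ᴿ p) ^ᴿ (p ℕ.^ k) + (y ^ᴿ p) ^ᴿ (p ℕ.^ k) ≈⟨ +-cong (pow-* x p (p ℕ.^ k)) (pow-* y p (p ℕ.^ k)) ⟨
      x ^ᴿ (p ℕ.* p ℕ.^ k) + y ^ᴿ (p ℕ.* p ℕ.^ k)   ∎

module FiniteField {c ℓ} (F : CommutativeRing c ℓ) {N} (isFF : IsFiniteFieldOfOrder F N) where
  open CommutativeRing F
  open IsFiniteFieldOfOrder isFF
  open import Relation.Binary.Reasoning.Setoid setoid
  open import Algebra.Properties.Group +-group using (identityʳ-unique; x∙y⁻¹≈ε⇒x≈y)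
  open import Algebra.Properties.Semiring.Mult semiring using () renaming (_×_ to _·_)
  import Algebra.Properties.CommutativeMonoid.Sum
  open Powers F

  toFin-injective : ∀ {x y} → toFin x ≡ toFin y → x ≈ y
  toFin-injective {x} {y} toFin-x≡toFin-y = begin
    x                   ≈⟨ from-to x ⟨
    fromFin (toFin x)   ≡⟨ ≡.cong fromFin toFin-x≡toFin-y ⟩
    fromFin (toFin y)   ≈⟨ from-to y ⟩
    y                   ∎

  _≟_ : Decidable _≈_
  x ≟ y = Dec.map′ toFin-injective toFin-cong (toFin x Fin.≟ toFin y)

  *-cancelˡ : ∀ {x y z} → ¬ x ≈ 0# → x * y ≈ x * z → y ≈ z
  *-cancelˡ {x} {y} {z} x≉0 xy≈xz with x⁻¹ , xx⁻¹≈1 ← invertible x x≉0 = begin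
    y                 ≈⟨ *-identityˡ y ⟨
    1# * y            ≈⟨ *-congʳ (trans (*-comm x⁻¹ x) xx⁻¹≈1) ⟨
    (x⁻¹ * x) * y     ≈⟨ *-assoc x⁻¹ x y ⟩
    x⁻¹ * (x * y)     ≈⟨ *-congˡ xy≈xz ⟩
    x⁻¹ * (x * z)     ≈⟨ *-assoc x⁻¹ x z ⟨
    (x⁻¹ * x) * z     ≈⟨ *-congʳ (trans (*-comm x⁻¹ x) xx⁻¹≈1) ⟩
    1# * z            ≈⟨ *-identityˡ z ⟩
    z                 ∎

  x*y≈0⇒x≈0∨y≈0 : ∀ {x y} → x * y ≈ 0# → x ≈ 0# ⊎ y ≈ 0#
  x*y≈0⇒x≈0∨y≈0 {x} {y} xy≈0 with x ≟ 0#
  ... | yes x≈0 = inj₁ x≈0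
  ... | no  x≉0 = inj₂ (*-cancelˡ x≉0 (trans xy≈0 (sym (zeroʳ x))))

  pow≈0⇒≈0 : ∀ {x} n → x ^ᴿ n ≈ 0# → x ≈ 0#
  pow≈0⇒≈0 zero    1≈0 = contradiction 1≈0 one≉zero
  pow≈0⇒≈0 (suc n) xxⁿ≈0 with x*y≈0⇒x≈0∨y≈0 xxⁿ≈0
  ... | inj₁ x≈0  = x≈0
  ... | inj₂ xⁿ≈0 = pow≈0⇒≈0 n xⁿ≈0

  injective⇒permutation : ∀ g → (∀ x y → g x ≈ g y → x ≈ y) → IsPermutation F g
  injective⇒permutation g g-inj = g-inj , g-surj
    where
    G : Fin N → Fin N
    G i = toFin (g (fromFin i))
    G-inj : Injective _≡_ _≡_ G
    G-inj {i} {j} Gi≡Gj =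
      ≡.trans (≡.sym (to-from i)) (≡.trans (toFin-cong (g-inj _ _ (toFin-injective Gi≡Gj))) (to-from j))
    g-surj : ∀ y → ∃ λ x → g x ≈ y
    g-surj y with i , Gi≡y ← injective⇒surjective G G-inj (toFin y) = fromFin i , toFin-injective Gi≡y

  module _ {a ℓ′} (M : CommutativeMonoid a ℓ′) where
    private module M = CommutativeMonoid M
    open import Algebra.Properties.CommutativeMonoid.Sum M using (sum; sum-permute; sum-cong-≋)

    sum-reindex : (g : Carrier → M.Carrier) → (∀ {x y} → x ≈ y → g x M.≈ g y)
                → (u v : Carrier → Carrier)
                → (∀ {x y} → x ≈ y → u x ≈ u y) → (∀ {x y} → x ≈ y → v x ≈ v y)
                → (∀ x → u (v x) ≈ x) → (∀ x → v (u x) ≈ x)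
                → sum (g ∘ fromFin) M.≈ sum (g ∘ u ∘ fromFin)
    sum-reindex g g-cong u v u-cong v-cong u∘v≈id v∘u≈id =
      M.trans (sum-permute (g ∘ fromFin) π) (sum-cong-≋ (λ i → g-cong (from-to (u (fromFin i)))))
      where
      on-indices : (Carrier → Carrier) → Fin N → Fin N
      on-indices h i = toFin (h (fromFin i))
      π : Permutation N N
      π = permutation (on-indices u) (on-indices v)
            (λ i → ≡.trans (toFin-cong (trans (u-cong (from-to _)) (u∘v≈id _))) (to-from i))
            (λ i → ≡.trans (toFin-cong (trans (v-cong (from-to _)) (v∘u≈id _))) (to-from i))

  private
    module Σ = Algebra.Properties.CommutativeMonoid.Sum +-commutativeMonoid
    module Π = Algebra.Properties.CommutativeMonoid.Sum *-commutativeMonoid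

  N·1≈0 : N · 1# ≈ 0#
  N·1≈0 = identityʳ-unique S (N · 1#) (sym S≈S+N·1)
    where
    S : Carrier
    S = Σ.sum fromFin
    +-cancel : ∀ {x y z} → y + z ≈ 0# → x + (y + z) ≈ x
    +-cancel {x} y+z≈0 = trans (+-congˡ y+z≈0) (+-identityʳ x)
    S≈S+N·1 : S ≈ S + N · 1#
    S≈S+N·1 = begin
      S                                  ≈⟨ sum-reindex +-commutativeMonoid id id (_+ 1#) (_- 1#) +-congʳ +-congʳ
                                              (λ x → trans (+-assoc x _ _) (+-cancel (-‿inverseˡ 1#)))
                                              (λ x → trans (+-assoc x _ _) (+-cancel (-‿inverseʳ 1#))) ⟩
      Σ.sum (λ i → fromFin i + 1#)       ≈⟨ Σ.∑-distrib-+ fromFin (λ _ → 1#) ⟩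
      S + Σ.sum {N} (λ _ → 1#)           ≈⟨ +-congˡ (Σ.sum-replicate N) ⟩
      S + N · 1#                         ∎

  private
    orOne : Carrier → Carrier
    orOne x with x ≟ 0#
    ... | yes _ = 1#
    ... | no  _ = x

    orOne-cong : ∀ {x y} → x ≈ y → orOne x ≈ orOne y
    orOne-cong {x} {y} x≈y with x ≟ 0# | y ≟ 0#
    ... | yes _   | yes _   = refl
    ... | yes x≈0 | no  y≉0 = contradiction (trans (sym x≈y) x≈0) y≉0
    ... | no  x≉0 | yes y≈0 = contradiction (trans x≈y y≈0) x≉0
    ... | no  _   | no  _   = x≈y

    orOne≉0 : ∀ x → ¬ orOne x ≈ 0#
    orOne≉0 x with x ≟ 0#
    ... | yes _   = one≉zero
    ... | no  x≉0 = x≉0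

    orOne-≈0 : ∀ {x} → x ≈ 0# → orOne x ≈ 1#
    orOne-≈0 {x} x≈0 with x ≟ 0#
    ... | yes _   = refl
    ... | no  x≉0 = contradiction x≈0 x≉0

    orOne-≉0 : ∀ {x} → ¬ x ≈ 0# → orOne x ≈ x
    orOne-≉0 {x} x≉0 with x ≟ 0#
    ... | yes x≈0 = contradiction x≈0 x≉0
    ... | no  _   = refl

  Π-const : ∀ n x → Π.sum {n} (λ _ → x) ≈ x ^ᴿ n
  Π-const zero    x = refl
  Π-const (suc n) x = *-congˡ (Π-const n x)

  Π≉0 : ∀ {n} (t : Fin n → Carrier) → (∀ i → ¬ t i ≈ 0#) → ¬ Π.sum t ≈ 0#
  Π≉0 {zero}  t t≉0 = one≉zero
  Π≉0 {suc n} t t≉0 Πt≈0 with x*y≈0⇒x≈0∨y≈0 Πt≈0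
  ... | inj₁ t₀≈0 = t≉0 Fin.zero t₀≈0
  ... | inj₂ Π≈0  = Π≉0 (t ∘ Fin.suc) (t≉0 ∘ Fin.suc) Π≈0

  -- Multiplication by a ≉ 0 permutes F, so it fixes P = ∏ₓ orOne x; but a * orOne x and
  -- orOne (a * x) agree except at x = 0, which turns this into a ^ N * P ≈ a * P.
  fermat : ∀ a → a ^ᴿ N ≈ a
  fermat a with a ≟ 0#
  ... | yes a≈0 = begin
    a ^ᴿ N    ≈⟨ pow-cong N a≈0 ⟩
    0# ^ᴿ N   ≈⟨ pow-zeroˡ N {{Fin.nonZeroIndex (toFin 0#)}} ⟩
    0#        ≈⟨ a≈0 ⟨
    a         ∎
  ... | no a≉0 with a⁻¹ , aa⁻¹≈1 ← invertible a a≉0 =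
    *-cancelˡ (Π≉0 (orOne ∘ fromFin) (orOne≉0 ∘ fromFin)) (begin
    P * a ^ᴿ N                                ≈⟨ *-comm P _ ⟩
    a ^ᴿ N * P                                ≈⟨ *-congʳ (Π-const N a) ⟨
    Π.sum {N} (λ _ → a) * P                   ≈⟨ Π.∑-distrib-+ (λ _ → a) (orOne ∘ fromFin) ⟨
    Π.sum (λ i → a * orOne (fromFin i))       ≈⟨ *-identityˡ _ ⟨
    1# * Π.sum (λ i → a * orOne (fromFin i))  ≈⟨ *-congʳ (orOne-≈0 (trans (*-congˡ (from-to 0#)) (zeroʳ a))) ⟨
    orOne (a * fromFin z) * Π.sum (λ i → a * orOne (fromFin i))
                                              ≈⟨ sum-exchange *-commutativeMonoid _ _ z agree ⟩
    (a * orOne (fromFin z)) * Π.sum (λ i → orOne (a * fromFin i))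
                                              ≈⟨ *-cong (trans (*-congˡ (orOne-≈0 (from-to 0#))) (*-identityʳ a))
                                                        (sym P≈Πa) ⟩
    a * P                                     ≈⟨ *-comm a P ⟩
    P * a                                     ∎)
    where
    z : Fin N
    z = toFin 0#
    P : Carrier
    P = Π.sum (orOne ∘ fromFin)
    *-cancel : ∀ {x y z} → x * y ≈ 1# → (x * y) * z ≈ z
    *-cancel {z = z} xy≈1 = trans (*-congʳ xy≈1) (*-identityˡ z)
    P≈Πa : P ≈ Π.sum (λ i → orOne (a * fromFin i))
    P≈Πa = sum-reindex *-commutativeMonoid orOne orOne-cong (a *_) (a⁻¹ *_) *-congˡ *-congˡ
             (λ x → trans (sym (*-assoc a a⁻¹ x)) (*-cancel aa⁻¹≈1))
             (λ x → trans (sym (*-assoc a⁻¹ a x)) (*-cancel (trans (*-comm a⁻¹ a) aa⁻¹≈1)))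
    agree : ∀ i → i ≢ z → a * orOne (fromFin i) ≈ orOne (a * fromFin i)
    agree i i≢z = trans (*-congˡ (orOne-≉0 xᵢ≉0)) (sym (orOne-≉0 axᵢ≉0))
      where
      xᵢ≉0 : ¬ fromFin i ≈ 0#
      xᵢ≉0 xᵢ≈0 = i≢z (≡.trans (≡.sym (to-from i)) (toFin-cong xᵢ≈0))
      axᵢ≉0 : ¬ a * fromFin i ≈ 0#
      axᵢ≉0 axᵢ≈0 = [ a≉0 , xᵢ≉0 ]′ (x*y≈0⇒x≈0∨y≈0 axᵢ≈0)

  planar-by-polarisation : (f : Carrier → Carrier) (B : Carrier → Carrier → Carrier)
    → (∀ x y ε → (f (x + ε) - f x) - (f (y + ε) - f y) ≈ B (x - y) ε)
    → (∀ a ε → ¬ ε ≈ 0# → B a ε ≈ 0# → a ≈ 0#)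
    → Planar F f
  planar-by-polarisation f B ΔΔ≈B B-nondegenerate ε ε≉0 = injective⇒permutation Δ Δ-injective
    where
    Δ : Carrier → Carrier
    Δ x = f (x + ε) - f x
    Δ-injective : ∀ x y → Δ x ≈ Δ y → x ≈ y
    Δ-injective x y Δx≈Δy = x∙y⁻¹≈ε⇒x≈y x y (B-nondegenerate (x - y) ε ε≉0 (begin
      B (x - y) ε      ≈⟨ ΔΔ≈B x y ε ⟨
      Δ x - Δ y        ≈⟨ +-congʳ Δx≈Δy ⟩
      Δ y - Δ y        ≈⟨ -‿inverseʳ (Δ y) ⟩
      0#               ∎))

rotate : ∀ {a} {A : Set a} → Vec A 3 → Vec A 3
rotate (x ∷ y ∷ z ∷ []) = y ∷ z ∷ x ∷ []

module Conjugation {c ℓ} (F : CommutativeRing c ℓ) where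
  open CommutativeRing F
  open IntegerCoefficients F
  open import Relation.Binary.Reasoning.Setoid setoid
  open import Algebra.Properties.Group +-group using (identityʳ-unique; inverseʳ-unique)
  open import Algebra.Properties.Semiring.Mult.TCOptimised semiring using () renaming (_×_ to _·_)
  open import Algebra.Properties.Semiring.Exp semiring using (^-congˡ) renaming (_^_ to _^ᴱ_)

  module OfOrderThree
    (σ : Carrier → Carrier)
    (σ-cong : ∀ {x y} → x ≈ y → σ x ≈ σ y)
    (σ-homo-+ : ∀ x y → σ (x + y) ≈ σ x + σ y)
    (σ-homo-* : ∀ x y → σ (x * y) ≈ σ x * σ y)
    (σ-homo-1# : σ 1# ≈ 1#)
    (σ³≈id : ∀ x → σ (σ (σ x)) ≈ x)
    where

    σ-homo-0# : σ 0# ≈ 0#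
    σ-homo-0# = identityʳ-unique (σ 0#) (σ 0#) (trans (sym (σ-homo-+ 0# 0#)) (σ-cong (+-identityʳ 0#)))

    σ-homo-‿ : ∀ x → σ (- x) ≈ - σ x
    σ-homo-‿ x = inverseʳ-unique (σ x) (σ (- x))
      (trans (sym (σ-homo-+ x (- x))) (trans (σ-cong (-‿inverseʳ x)) σ-homo-0#))

    σ-homo-· : ∀ n → σ (n · 1#) ≈ n · 1#
    σ-homo-· zero          = σ-homo-0#
    σ-homo-· (suc zero)    = σ-homo-1#
    σ-homo-· (suc (suc n)) = trans (σ-homo-+ (suc n · 1#) 1#) (+-cong (σ-homo-· (suc n)) σ-homo-1#)

    σ-homo-fromℤ : ∀ i → σ (fromℤ i) ≈ fromℤ i
    σ-homo-fromℤ (+ n)    = σ-homo-· n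
    σ-homo-fromℤ -[1+ n ] = trans (σ-homo-‿ _) (-‿cong (σ-homo-· (suc n)))

    σ-homo-^ : ∀ x n → σ (x ^ᴱ n) ≈ σ x ^ᴱ n
    σ-homo-^ x zero    = σ-homo-1#
    σ-homo-^ x (suc n) = trans (σ-homo-* x (x ^ᴱ n)) (*-congˡ (σ-homo-^ x n))

    σ-homo-⟦⟧ : ∀ {n} (e : Polynomial n) ρ → σ (⟦ e ⟧ ρ) ≈ ⟦ e ⟧ (Vec.map σ ρ)
    σ-homo-⟦⟧ (op [+] e₁ e₂) ρ = trans (σ-homo-+ _ _) (+-cong (σ-homo-⟦⟧ e₁ ρ) (σ-homo-⟦⟧ e₂ ρ))
    σ-homo-⟦⟧ (op [*] e₁ e₂) ρ = trans (σ-homo-* _ _) (*-cong (σ-homo-⟦⟧ e₁ ρ) (σ-homo-⟦⟧ e₂ ρ))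
    σ-homo-⟦⟧ (con i)        ρ = σ-homo-fromℤ i
    σ-homo-⟦⟧ (var x)        ρ = reflexive (≡.sym (Vec.lookup-map x σ ρ))
    σ-homo-⟦⟧ (e :^ n)       ρ = trans (σ-homo-^ _ n) (^-congˡ n (σ-homo-⟦⟧ e ρ))
    σ-homo-⟦⟧ (:- e)         ρ = trans (σ-homo-‿ _) (-‿cong (σ-homo-⟦⟧ e ρ))

    ⟦⟧≈0-σ : ∀ {n} (e : Polynomial n) ρ → ⟦ e ⟧ ρ ≈ 0# → ⟦ e ⟧ (Vec.map σ ρ) ≈ 0#
    ⟦⟧≈0-σ e ρ ⟦e⟧≈0 = trans (sym (σ-homo-⟦⟧ e ρ)) (trans (σ-cong ⟦e⟧≈0) σ-homo-0#)

    conjugates : Carrier → Vec Carrier 3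
    conjugates x = x ∷ σ x ∷ σ (σ x) ∷ []

    conjugates-σ : ∀ x → Pointwise _≈_ (conjugates (σ x)) (rotate (conjugates x))
    conjugates-σ x = refl ∷ refl ∷ σ³≈id x ∷ []

    conjugates-σ² : ∀ x → Pointwise _≈_ (conjugates (σ (σ x))) (rotate (rotate (conjugates x)))
    conjugates-σ² x = refl ∷ σ³≈id x ∷ σ³≈id (σ x) ∷ []

    conjugates-+ : ∀ x y → Pointwise _≈_ (conjugates (x + y)) (Vec.zipWith _+_ (conjugates x) (conjugates y))
    conjugates-+ x y = refl ∷ σ-homo-+ x y ∷ trans (σ-cong (σ-homo-+ x y)) (σ-homo-+ (σ x) (σ y)) ∷ []

    conjugates-- : ∀ x y → Pointwise _≈_ (conjugates (x - y)) (Vec.zipWith _-_ (conjugates x) (conjugates y))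
    conjugates-- x y = refl ∷ σ-homo-- x y ∷ trans (σ-cong (σ-homo-- x y)) (σ-homo-- (σ x) (σ y)) ∷ []
      where
      σ-homo-- : ∀ x y → σ (x - y) ≈ σ x - σ y
      σ-homo-- x y = trans (σ-homo-+ x (- y)) (+-congˡ (σ-homo-‿ y))

    conjugate-polarisation : (f : Carrier → Carrier) (Q : Vec Carrier 3 → Carrier)
      → (∀ {u v} → Pointwise _≈_ u v → Q u ≈ Q v) → (∀ x → f x ≈ Q (conjugates x)) → (β : Polynomial 6)
      → (∀ u v e → (Q (Vec.zipWith _+_ u e) - Q u) - (Q (Vec.zipWith _+_ v e) - Q v)
                   ≈ ⟦ β ⟧ (Vec.zipWith _-_ u v ++ e))
      → ∀ x y ε → (f (x + ε) - f x) - (f (y + ε) - f y) ≈ ⟦ β ⟧ (conjugates (x - y) ++ conjugates ε)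
    conjugate-polarisation f Q Q-cong f≈Q β Q-polarisation x y ε = begin
      (f (x + ε) - f x) - (f (y + ε) - f y)
        ≈⟨ +-cong (+-cong (f≈Q+ x) (-‿cong (f≈Q x))) (-‿cong (+-cong (f≈Q+ y) (-‿cong (f≈Q y)))) ⟩
      (Q (Vec.zipWith _+_ (conjugates x) (conjugates ε)) - Q (conjugates x))
        - (Q (Vec.zipWith _+_ (conjugates y) (conjugates ε)) - Q (conjugates y))
        ≈⟨ Q-polarisation (conjugates x) (conjugates y) (conjugates ε) ⟩
      ⟦ β ⟧ (Vec.zipWith _-_ (conjugates x) (conjugates y) ++ conjugates ε)
        ≈⟨ ⟦⟧-cong β (Pointwise.++⁺ (conjugates-- x y) (Pointwise.refl refl)) ⟨
      ⟦ β ⟧ (conjugates (x - y) ++ conjugates ε) ∎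
      where
      f≈Q+ : ∀ x → f (x + ε) ≈ Q (Vec.zipWith _+_ (conjugates x) (conjugates ε))
      f≈Q+ x = trans (f≈Q (x + ε)) (Q-cong (conjugates-+ x ε))

    module CyclicKernel
      (x*y≈0⇒x≈0∨y≈0 : ∀ {x y} → x * y ≈ 0# → x ≈ 0# ⊎ y ≈ 0#)
      (x+x≈0⇒x≈0 : ∀ {x} → x + x ≈ 0# → x ≈ 0#)
      (μ : Polynomial 3) (k₀ k₁ k₂ : Carrier)
      (μ-cyclic : ∀ u → Vec.head u + Vec.head u
                        ≈ k₀ * ⟦ μ ⟧ u + k₁ * ⟦ μ ⟧ (rotate u) + k₂ * ⟦ μ ⟧ (rotate (rotate u)))
      where

      combination≈0 : ∀ l₀ l₁ l₂ {x y z} → x ≈ 0# → y ≈ 0# → z ≈ 0# → l₀ * x + l₁ * y + l₂ * z ≈ 0#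
      combination≈0 l₀ l₁ l₂ x≈0 y≈0 z≈0 = begin
        l₀ * _ + l₁ * _ + l₂ * _    ≈⟨ +-cong (+-cong (*-congˡ x≈0) (*-congˡ y≈0)) (*-congˡ z≈0) ⟩
        l₀ * 0# + l₁ * 0# + l₂ * 0# ≈⟨ +-cong (+-cong (zeroʳ l₀) (zeroʳ l₁)) (zeroʳ l₂) ⟩
        0# + 0# + 0#                ≈⟨ trans (+-identityʳ _) (+-identityʳ 0#) ⟩
        0#                          ∎

      μ-nondegenerate : ∀ c → ⟦ μ ⟧ (conjugates c) ≈ 0# → c ≈ 0#
      μ-nondegenerate c μ≈0 =
        x+x≈0⇒x≈0 (trans (μ-cyclic (conjugates c)) (combination≈0 k₀ k₁ k₂ μ≈0 μσ≈0 μσ²≈0))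
        where
        μσ≈0 : ⟦ μ ⟧ (rotate (conjugates c)) ≈ 0#
        μσ≈0 = trans (sym (⟦⟧-cong μ (conjugates-σ c))) (⟦⟧≈0-σ μ (conjugates c) μ≈0)
        μσ²≈0 : ⟦ μ ⟧ (rotate (rotate (conjugates c))) ≈ 0#
        μσ²≈0 = trans (sym (⟦⟧-cong μ (conjugates-σ² c)))
                      (⟦⟧≈0-σ μ (conjugates (σ c)) (⟦⟧≈0-σ μ (conjugates c) μ≈0))

      β-nondegenerate : (β : Polynomial 6) (l₀ l₁ l₂ : Carrier)
        → (∀ u v → ⟦ μ ⟧ u * ⟦ μ ⟧ v + ⟦ μ ⟧ u * ⟦ μ ⟧ v
                   ≈ l₀ * ⟦ β ⟧ (u ++ v) + l₁ * ⟦ β ⟧ (rotate u ++ rotate v)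
                     + l₂ * ⟦ β ⟧ (rotate (rotate u) ++ rotate (rotate v)))
        → ∀ a b → ¬ b ≈ 0# → ⟦ β ⟧ (conjugates a ++ conjugates b) ≈ 0# → a ≈ 0#
      β-nondegenerate β l₀ l₁ l₂ β-cyclic a b b≉0 β≈0
        with x*y≈0⇒x≈0∨y≈0 (x+x≈0⇒x≈0
               (trans (β-cyclic (conjugates a) (conjugates b)) (combination≈0 l₀ l₁ l₂ β≈0 βσ≈0 βσ²≈0)))
        where
        βσ≈0 : ⟦ β ⟧ (rotate (conjugates a) ++ rotate (conjugates b)) ≈ 0#
        βσ≈0 = trans (sym (⟦⟧-cong β (Pointwise.++⁺ (conjugates-σ a) (conjugates-σ b))))
                     (⟦⟧≈0-σ β (conjugates a ++ conjugates b) β≈0)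
        βσ²≈0 : ⟦ β ⟧ (rotate (rotate (conjugates a)) ++ rotate (rotate (conjugates b))) ≈ 0#
        βσ²≈0 = trans (sym (⟦⟧-cong β (Pointwise.++⁺ (conjugates-σ² a) (conjugates-σ² b))))
                      (⟦⟧≈0-σ β (conjugates (σ a) ++ conjugates (σ b))
                         (⟦⟧≈0-σ β (conjugates a ++ conjugates b) β≈0))
      ... | inj₁ μa≈0 = μ-nondegenerate a μa≈0
      ... | inj₂ μb≈0 = contradiction (μ-nondegenerate b μb≈0) b≉0

module QuadraticForms {c ℓ} (F : CommutativeRing c ℓ) where
  open CommutativeRing F
  open IntegerCoefficients F
  open import Relation.Binary.Reasoning.Setoid setoid

  -- A form is kept as a function of its argument polynomials, so that solver goals can feed it
  -- shifted or rotated variables; generic e is e applied to the variables themselves.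
  Form : ℕ → Set
  Form k = ∀ {n} → Vec (Polynomial n) k → Polynomial n

  generic : ∀ {k} → Form k → Polynomial k
  generic e = e (Vec.tabulate var)

  two : ∀ {n} → Polynomial n
  two = con (+ 2)

  q₁ : Form 3
  q₁ (x₀ ∷ x₁ ∷ x₂ ∷ []) = x₀ :* x₀ :- x₁ :* x₀ :- x₂ :* x₀ :+ x₁ :* x₁ :+ x₂ :* x₂

  β₁ : Form 6
  β₁ (a₀ ∷ a₁ ∷ a₂ ∷ b₀ ∷ b₁ ∷ b₂ ∷ []) =
    two :* a₀ :* b₀ :- (a₁ :* b₀ :+ a₀ :* b₁) :- (a₂ :* b₀ :+ a₀ :* b₂)
      :+ two :* a₁ :* b₁ :+ two :* a₂ :* b₂

  μ₁ : Form 3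
  μ₁ (a₀ ∷ a₁ ∷ a₂ ∷ []) = a₀ :- a₁ :- a₂

  q₂ : Form 4
  q₂ (h ∷ x₀ ∷ x₁ ∷ x₂ ∷ []) = x₀ :* x₀ :+ x₁ :* x₀ :+ x₂ :* x₀ :+ h :* (x₁ :* x₁) :+ h :* (x₂ :* x₂)

  β₂ : Form 6
  β₂ (a₀ ∷ a₁ ∷ a₂ ∷ b₀ ∷ b₁ ∷ b₂ ∷ []) =
    two :* a₀ :* b₀ :+ (a₁ :* b₀ :+ a₀ :* b₁) :+ (a₂ :* b₀ :+ a₀ :* b₂) :+ a₁ :* b₁ :+ a₂ :* b₂

  μ₂ : Form 3
  μ₂ (a₀ ∷ a₁ ∷ a₂ ∷ []) = a₁ :+ a₂

  q₁-polarisation : ∀ u v e →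
    (⟦ generic q₁ ⟧ (Vec.zipWith _+_ u e) - ⟦ generic q₁ ⟧ u)
      - (⟦ generic q₁ ⟧ (Vec.zipWith _+_ v e) - ⟦ generic q₁ ⟧ v)
    ≈ ⟦ generic β₁ ⟧ (Vec.zipWith _-_ u v ++ e)
  q₁-polarisation (x₀ ∷ x₁ ∷ x₂ ∷ []) (y₀ ∷ y₁ ∷ y₂ ∷ []) (e₀ ∷ e₁ ∷ e₂ ∷ []) =
    solve 9 (λ x₀ x₁ x₂ y₀ y₁ y₂ e₀ e₁ e₂ →
      let x = x₀ ∷ x₁ ∷ x₂ ∷ []; y = y₀ ∷ y₁ ∷ y₂ ∷ []; e = e₀ ∷ e₁ ∷ e₂ ∷ [] in
      (q₁ (Vec.zipWith _:+_ x e) :- q₁ x) :- (q₁ (Vec.zipWith _:+_ y e) :- q₁ y)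
      := β₁ (Vec.zipWith _:-_ x y ++ e))
      refl x₀ x₁ x₂ y₀ y₁ y₂ e₀ e₁ e₂

  q₂-polarisation : ∀ {h} → (1# + 1#) * h ≈ 1# → ∀ u v e →
    (⟦ generic q₂ ⟧ (h ∷ Vec.zipWith _+_ u e) - ⟦ generic q₂ ⟧ (h ∷ u))
      - (⟦ generic q₂ ⟧ (h ∷ Vec.zipWith _+_ v e) - ⟦ generic q₂ ⟧ (h ∷ v))
    ≈ ⟦ generic β₂ ⟧ (Vec.zipWith _-_ u v ++ e)
  q₂-polarisation {h} 2h≈1 (x₀ ∷ x₁ ∷ x₂ ∷ []) (y₀ ∷ y₁ ∷ y₂ ∷ []) (e₀ ∷ e₁ ∷ e₂ ∷ []) = begin
    _ ≈⟨ solve 10 (λ h x₀ x₁ x₂ y₀ y₁ y₂ e₀ e₁ e₂ →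
           let x = x₀ ∷ x₁ ∷ x₂ ∷ []; y = y₀ ∷ y₁ ∷ y₂ ∷ []; e = e₀ ∷ e₁ ∷ e₂ ∷ [] in
           (q₂ (h ∷ Vec.zipWith _:+_ x e) :- q₂ (h ∷ x)) :- (q₂ (h ∷ Vec.zipWith _:+_ y e) :- q₂ (h ∷ y))
           := β₂ (Vec.zipWith _:-_ x y ++ e) :+ (two :* h :- con (+ 1)) :* ((x₁ :- y₁) :* e₁ :+ (x₂ :- y₂) :* e₂))
           refl h x₀ x₁ x₂ y₀ y₁ y₂ e₀ e₁ e₂ ⟩
    B + ((1# + 1#) * h - 1#) * C  ≈⟨ +-congˡ (*-congʳ (trans (+-congʳ 2h≈1) (-‿inverseʳ 1#))) ⟩
    B + 0# * C                    ≈⟨ +-congˡ (zeroˡ C) ⟩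
    B + 0#                        ≈⟨ +-identityʳ B ⟩
    B                             ∎
    where
    B C : Carrier
    B = ⟦ generic β₂ ⟧ (x₀ - y₀ ∷ x₁ - y₁ ∷ x₂ - y₂ ∷ e₀ ∷ e₁ ∷ e₂ ∷ [])
    C = (x₁ - y₁) * e₁ + (x₂ - y₂) * e₂

  μ₁-cyclic : ∀ u → Vec.head u + Vec.head u
    ≈ 0# * ⟦ generic μ₁ ⟧ u + fromℤ -1ℤ * ⟦ generic μ₁ ⟧ (rotate u) + fromℤ -1ℤ * ⟦ generic μ₁ ⟧ (rotate (rotate u))
  μ₁-cyclic (a₀ ∷ a₁ ∷ a₂ ∷ []) =
    solve 3 (λ a₀ a₁ a₂ → let a = a₀ ∷ a₁ ∷ a₂ ∷ [] in
      a₀ :+ a₀ := con 0ℤ :* μ₁ a :+ con -1ℤ :* μ₁ (rotate a) :+ con -1ℤ :* μ₁ (rotate (rotate a)))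
      refl a₀ a₁ a₂

  μ₂-cyclic : ∀ u → Vec.head u + Vec.head u
    ≈ fromℤ -1ℤ * ⟦ generic μ₂ ⟧ u + 1# * ⟦ generic μ₂ ⟧ (rotate u) + 1# * ⟦ generic μ₂ ⟧ (rotate (rotate u))
  μ₂-cyclic (a₀ ∷ a₁ ∷ a₂ ∷ []) =
    solve 3 (λ a₀ a₁ a₂ → let a = a₀ ∷ a₁ ∷ a₂ ∷ [] in
      a₀ :+ a₀ := con -1ℤ :* μ₂ a :+ con (+ 1) :* μ₂ (rotate a) :+ con (+ 1) :* μ₂ (rotate (rotate a)))
      refl a₀ a₁ a₂

  β₁-cyclic : ∀ u v → ⟦ generic μ₁ ⟧ u * ⟦ generic μ₁ ⟧ v + ⟦ generic μ₁ ⟧ u * ⟦ generic μ₁ ⟧ v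
    ≈ fromℤ (+ 3) * ⟦ generic β₁ ⟧ (u ++ v) + fromℤ -1ℤ * ⟦ generic β₁ ⟧ (rotate u ++ rotate v)
      + fromℤ -1ℤ * ⟦ generic β₁ ⟧ (rotate (rotate u) ++ rotate (rotate v))
  β₁-cyclic (a₀ ∷ a₁ ∷ a₂ ∷ []) (b₀ ∷ b₁ ∷ b₂ ∷ []) =
    solve 6 (λ a₀ a₁ a₂ b₀ b₁ b₂ → let a = a₀ ∷ a₁ ∷ a₂ ∷ []; b = b₀ ∷ b₁ ∷ b₂ ∷ [] in
      μ₁ a :* μ₁ b :+ μ₁ a :* μ₁ b
      := con (+ 3) :* β₁ (a ++ b) :+ con -1ℤ :* β₁ (rotate a ++ rotate b)
         :+ con -1ℤ :* β₁ (rotate (rotate a) ++ rotate (rotate b)))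
      refl a₀ a₁ a₂ b₀ b₁ b₂

  β₂-cyclic : ∀ u v → ⟦ generic μ₂ ⟧ u * ⟦ generic μ₂ ⟧ v + ⟦ generic μ₂ ⟧ u * ⟦ generic μ₂ ⟧ v
    ≈ fromℤ -1ℤ * ⟦ generic β₂ ⟧ (u ++ v) + 1# * ⟦ generic β₂ ⟧ (rotate u ++ rotate v)
      + 1# * ⟦ generic β₂ ⟧ (rotate (rotate u) ++ rotate (rotate v))
  β₂-cyclic (a₀ ∷ a₁ ∷ a₂ ∷ []) (b₀ ∷ b₁ ∷ b₂ ∷ []) =
    solve 6 (λ a₀ a₁ a₂ b₀ b₁ b₂ → let a = a₀ ∷ a₁ ∷ a₂ ∷ []; b = b₀ ∷ b₁ ∷ b₂ ∷ [] in
      μ₂ a :* μ₂ b :+ μ₂ a :* μ₂ b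
      := con -1ℤ :* β₂ (a ++ b) :+ con (+ 1) :* β₂ (rotate a ++ rotate b)
         :+ con (+ 1) :* β₂ (rotate (rotate a) ++ rotate (rotate b)))
      refl a₀ a₁ a₂ b₀ b₁ b₂

module FrobeniusOfCubicExtension {c ℓ} (F : CommutativeRing c ℓ) {p k} (p-prime : Prime p)
  (isFF : IsFiniteFieldOfOrder F ((p ^ k) ^ 3)) where
  open CommutativeRing F
  open import Relation.Binary.Reasoning.Setoid setoid
  open import Algebra.Properties.Semiring.Mult semiring using () renaming (_×_ to _·_)
  open Powers F
  open FiniteField F isFF
  open Frobenius F
  open IntegerCoefficients F using (⟦_⟧; ⟦⟧-cong; fromℤ; inverse-of-2-halving)
  open QuadraticForms F

  q : ℕ
  q = p ^ k

  p·1≈0 : p · 1# ≈ 0#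
  p·1≈0 = pow≈0⇒≈0 k (pow≈0⇒≈0 3 (begin
    ((p · 1#) ^ᴿ k) ^ᴿ 3   ≈⟨ pow-cong 3 (×1-homo-^ p k) ⟨
    (q · 1#) ^ᴿ 3          ≈⟨ ×1-homo-^ q 3 ⟨
    (q ^ 3) · 1#           ≈⟨ N·1≈0 ⟩
    0#                     ∎))

  odd-characteristic-halving : p ≢ 2 → ∀ {x} → x + x ≈ 0# → x ≈ 0#
  odd-characteristic-halving p≢2 {x} x+x≈0 with m , p≡1+m*2 ← prime≢2⇒odd p-prime p≢2 = begin
    x                    ≈⟨ +-identityʳ x ⟨
    x + 0#               ≈⟨ +-congˡ (even·x≈0 m) ⟨
    suc (m ℕ.* 2) · x    ≡⟨ ≡.cong (_· x) p≡1+m*2 ⟨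
    p · x                ≈⟨ p·x≈0 p-prime p·1≈0 x ⟩
    0#                   ∎
    where
    even·x≈0 : ∀ m → (m ℕ.* 2) · x ≈ 0#
    even·x≈0 zero    = refl
    even·x≈0 (suc m) = trans (sym (+-assoc x x _)) (trans (+-cong x+x≈0 (even·x≈0 m)) (+-identityʳ 0#))

  σ : Carrier → Carrier
  σ x = x ^ᴿ q

  σ³≈id : ∀ x → σ (σ (σ x)) ≈ x
  σ³≈id x = begin
    ((x ^ᴿ q) ^ᴿ q) ^ᴿ q     ≈⟨ pow-cong q (pow-* x q q) ⟨
    (x ^ᴿ (q ℕ.* q)) ^ᴿ q   ≈⟨ pow-* x (q ℕ.* q) q ⟨
    x ^ᴿ (q ℕ.* q ℕ.* q)    ≡⟨ ≡.cong (x ^ᴿ_) q*q*q≡q^3 ⟩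
    x ^ᴿ (q ^ 3)            ≈⟨ fermat x ⟩
    x                       ∎
    where
    q*q*q≡q^3 : q ℕ.* q ℕ.* q ≡ q ^ 3
    q*q*q≡q^3 = ≡.trans (ℕ.*-assoc q q q) (≡.cong (λ r → q ℕ.* (q ℕ.* r)) (≡.sym (ℕ.*-identityʳ q)))

  open Conjugation.OfOrderThree F σ (pow-cong q) (frobenius-power-homo-+ p-prime p·1≈0 k)
    (λ x y → pow-distrib-* x y q) (pow-1# q) σ³≈id

  module _ (x : Carrier) where
    private
      σ²x≈x^q² : σ (σ x) ≈ x ^ᴿ (q ℕ.* q)
      σ²x≈x^q² = sym (pow-* x q q)

      x²≈xx : x ^ᴿ 2 ≈ x * x
      x²≈xx = *-congˡ (*-identityʳ x)

      x^[q²+1]≈σ²x*x : x ^ᴿ (q ℕ.* q ℕ.+ 1) ≈ σ (σ x) * x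
      x^[q²+1]≈σ²x*x = trans (pow-+1 x (q ℕ.* q)) (*-congʳ (sym σ²x≈x^q²))

      x^[2q²]≈σ²x*σ²x : x ^ᴿ (2 ℕ.* (q ℕ.* q)) ≈ σ (σ x) * σ (σ x)
      x^[2q²]≈σ²x*σ²x = trans (pow-2* x (q ℕ.* q)) (sym (*-cong σ²x≈x^q² σ²x≈x^q²))

    f₁-expansion : f₁ F q x ≈ ⟦ generic q₁ ⟧ (conjugates x)
    f₁-expansion =
      +-cong (+-cong (+-cong (+-cong x²≈xx (-‿cong (pow-+1 x q))) (-‿cong x^[q²+1]≈σ²x*x)) (pow-2* x q))
             x^[2q²]≈σ²x*σ²x

    f₂-expansion : ∀ h → f₂ F q h x ≈ ⟦ generic q₂ ⟧ (h ∷ conjugates x)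
    f₂-expansion h =
      +-cong (+-cong (+-cong (+-cong x²≈xx (pow-+1 x q)) x^[q²+1]≈σ²x*x) (*-congˡ (pow-2* x q)))
             (*-congˡ x^[2q²]≈σ²x*σ²x)

  planar-f₁ : (∀ {x} → x + x ≈ 0# → x ≈ 0#) → Planar F (f₁ F q)
  planar-f₁ halving = planar-by-polarisation (f₁ F q) (λ a ε → ⟦ generic β₁ ⟧ (conjugates a ++ conjugates ε))
    (conjugate-polarisation (f₁ F q) ⟦ generic q₁ ⟧ (⟦⟧-cong (generic q₁)) f₁-expansion
      (generic β₁) q₁-polarisation)
    (β-nondegenerate (generic β₁) (fromℤ (+ 3)) (fromℤ -1ℤ) (fromℤ -1ℤ) β₁-cyclic)
    where open CyclicKernel x*y≈0⇒x≈0∨y≈0 halving (generic μ₁) 0# (fromℤ -1ℤ) (fromℤ -1ℤ) μ₁-cyclic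

  planar-f₂ : ∀ {h} → (1# + 1#) * h ≈ 1# → Planar F (f₂ F q h)
  planar-f₂ {h} 2h≈1 = planar-by-polarisation (f₂ F q h) (λ a ε → ⟦ generic β₂ ⟧ (conjugates a ++ conjugates ε))
    (conjugate-polarisation (f₂ F q h) (λ u → ⟦ generic q₂ ⟧ (h ∷ u))
      (λ u≈v → ⟦⟧-cong (generic q₂) (refl ∷ u≈v)) (λ x → f₂-expansion x h) (generic β₂) (q₂-polarisation 2h≈1))
    (β-nondegenerate (generic β₂) (fromℤ -1ℤ) 1# 1# β₂-cyclic)
    where open CyclicKernel x*y≈0⇒x≈0∨y≈0 (inverse-of-2-halving 2h≈1) (generic μ₂) (fromℤ -1ℤ) 1# 1# μ₂-cyclic

theorem3p4 : ∀ {c ℓ : Level} (p k q : ℕ) → Prime p → ¬ (p ≡ 2) → 1 ≤ k → q ≡ p ^ k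
    → (F : CommutativeRing c ℓ) → IsFiniteFieldOfOrder F (q ^ 3)
    → Planar F (f₁ F q)
    × (∀ h → CommutativeRing._≈_ F (CommutativeRing._*_ F (CommutativeRing._+_ F (CommutativeRing.1# F) (CommutativeRing.1# F)) h) (CommutativeRing.1# F)
    → Planar F (f₂ F q h))
theorem3p4 p k .(p ^ k) p-prime p≢2 _ ≡.refl F isFF =
  planar-f₁ (odd-characteristic-halving p≢2) , λ h 2h≈1 → planar-f₂ 2h≈1
  where open FrobeniusOfCubicExtension F {k = k} p-prime isFF
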